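{- Let $a,b$ be coprime natural numbers and let $k \geq 0$. Then for any $\lambda>0$, $$\mathrm{Poly}_{\leq k}\big(\tfrac{\lambda}{a} \mathbb{Z} \to \mathbb{Z}\big) + \mathrm{Poly}_{\leq k}\big(\tfrac{\lambda}{b} \mathbb{Z} \to \mathbb{Z}\big) = \mathrm{Poly}_{\leq k}(\lambda\mathbb{Z} \to \mathbb{Z})$$ and $$\mathrm{Poly}_{\leq k}\big(\tfrac{\lambda}{a} \mathbb{Z} \to \mathbb{Z}\big) \cap \mathrm{Poly}_{\leq k}\big(\tfrac{\lambda}{b} \mathbb{Z} \to \mathbb{Z}\big) = \mathrm{Poly}_{\leq k}\big(\tfrac{\lambda}{ab} \mathbb{Z} \to \mathbb{Z}\big).$$
   Context: For $\delta>0$, $\mathrm{Poly}_{\leq k}(\delta \mathbb{Z} \to \mathbb{Z})$ denotes the additive group of polynomials $\gamma:\mathbb{R}\to\mathbb{R}$ with real coefficients and degree at most $k$ such that $\gamma(\delta\mathbb{Z})\subset\mathbb{Z}$. The sum of two such groups is the set of sums $\gamma_1+\gamma_2$ with $\gamma_1,\gamma_2$ in the respective groups. -}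

module Defs where

open import Level using (0ℓ)
open import Data.Nat as ℕ using (ℕ; zero; suc)
open import Data.Integer as ℤ using (ℤ; +_; -[1+_])
open import Data.Fin using (Fin; toℕ)
open import Data.Sum using (_⊎_)
open import Data.Product using (Σ; ∃; _×_; _,_)
open import Relation.Binary.PropositionalEquality using (_≡_; _≢_)
open import Relation.Binary.Structures using (IsStrictTotalOrder)
open import Algebra.Structures using (IsCommutativeRing)

-- A model of the real numbers: a complete (Dedekind / least-upper-bound)
-- ordered field, with propositional equality on the carrier.
-- Any two such models are isomorphic, so quantifying over all of them
-- is the same as speaking about ℝ.
record RealField : Set₁ where
  infixl 6 _+_
  infixl 7 _*_
  infix  8 -_
  infix  9 _⁻¹
  infix  4 _<_
  field
    Carrier : Set
    _+_ _*_ : Carrier → Carrier → Carrier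
    -_      : Carrier → Carrier
    0# 1#   : Carrier
    _⁻¹     : Carrier → Carrier
    _<_     : Carrier → Carrier → Set
    isCommutativeRing : IsCommutativeRing _≡_ _+_ _*_ -_ 0# 1#
    0≢1     : 0# ≢ 1#
    ⁻¹-inverse : ∀ x → x ≢ 0# → x * (x ⁻¹) ≡ 1#
    isStrictTotalOrder : IsStrictTotalOrder _≡_ _<_
    +-mono-<  : ∀ x y z → x < y → x + z < y + z
    *-pos     : ∀ x y → 0# < x → 0# < y → 0# < x * y
    completeness : (P : Carrier → Set) → ∃ P →
                   ∃ (λ u → ∀ x → P x → (x < u) ⊎ (x ≡ u)) →
                   Σ Carrier λ s → (∀ x → P x → (x < s) ⊎ (x ≡ s)) ×
                     (∀ u → (∀ x → P x → (x < u) ⊎ (x ≡ u)) → (s < u) ⊎ (s ≡ u))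

module RealPoly (ℝ : RealField) where
  open RealField ℝ

  ιℕ : ℕ → Carrier
  ιℕ zero    = 0#
  ιℕ (suc n) = 1# + ιℕ n

  ιℤ : ℤ → Carrier
  ιℤ (+ n)     = ιℕ n
  ιℤ -[1+ n ]  = - ιℕ (suc n)

  _^_ : Carrier → ℕ → Carrier
  x ^ zero  = 1#
  x ^ suc n = x * (x ^ n)

  _/_ : Carrier → Carrier → Carrier
  x / y = x * (y ⁻¹)

  Poly≤ : ℕ → Set
  Poly≤ k = Fin (suc k) → Carrier

  sumFin : ∀ n → (Fin n → Carrier) → Carrier
  sumFin zero    f = 0#
  sumFin (suc n) f = f Fin.zero + sumFin n (λ i → f (Fin.suc i))
    where import Data.Fin as Fin

  eval : ∀ {k} → Poly≤ k → Carrier → Carrier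
  eval {k} c x = sumFin (suc k) (λ i → c i * (x ^ toℕ i))

  IntOn : ∀ {k} → Carrier → Poly≤ k → Set
  IntOn δ γ = ∀ (n : ℤ) → ∃ λ (m : ℤ) → eval γ (δ * ιℤ n) ≡ ιℤ m

{-# OPTIONS --safe #-}
-- For integer weights c and naturals s, the polynomial x ↦ Σ c γ(a s x) multiplies the
-- coefficient of x^i by the moment Σ c (a s)^i.  Such moments can be made to add up to 1
-- for all i ≤ k, using one combination with factors a s and one with factors b s:
-- Q(X) = Π_{j≤k} (a^j − X) vanishes at X = a^i, so Q(0) − Q(X), a combination of powers
-- X^e = (a^e)^i with e ≥ 1, has all these moments equal to Q(0) = a^(0+1+⋯+k); the same for b,
-- and a Bézout identity between the coprime numbers Q_a(0) and Q_b(0) yields 1.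
-- Hence γ = γᵃ + γᵇ with γᵃ(x) = Σ c γ(a s x), and γᵃ maps (λ/a)ℤ into γ(λℤ) and (λ/ab)ℤ
-- into γ((λ/b)ℤ).  This splits every γ integral on λℤ, and makes γ integral on (λ/ab)ℤ
-- as soon as it is integral on (λ/a)ℤ and on (λ/b)ℤ; the remaining inclusions follow from
-- λℤ ⊆ (λ/a)ℤ ⊆ (λ/ab)ℤ.
module Submission where

open import Defs
open import Level using (0ℓ)
open import Data.Nat as ℕ using (ℕ; zero; suc; _≥_)
import Data.Nat.Properties as ℕ
open import Data.Nat.Coprimality using (Coprime)
open import Data.Integer as ℤ using (ℤ)
import Data.Integer.Properties as ℤ
open import Data.Fin using (Fin; toℕ; zero; suc)
open import Data.Fin.Properties using (toℕ<n)
open import Data.List using ([]; _∷_)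
open import Data.Product using (Σ; ∃; ∃₂; _×_; _,_; proj₁; proj₂)
open import Data.Empty using (⊥-elim)
open import Relation.Binary.PropositionalEquality
open import Relation.Binary.Definitions using (tri<; tri≈; tri>)
open import Relation.Binary.Structures using (IsStrictTotalOrder)
open import Algebra.Bundles using (CommutativeRing)
open import Function.Bundles using (_⇔_; mk⇔)

module Moments where

  open import Data.Nat.Coprimality using (coprime-Bézout)
  open import Data.Nat.GCD using (module Bézout)
  open import Data.Integer using (+_; 0ℤ; 1ℤ; -1ℤ; -_; _+_; _*_; _-_)
  open import Data.List using (List; _++_; map)
  open import Data.Sum using (inj₁; inj₂)
  open import Algebra.Properties.CommutativeSemigroup ℕ.*-commutativeSemigroup using (interchange)
  open import Data.Integer.Tactic.RingSolver using (ring)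
  open import Tactic.RingSolver.NonReflective ring using (solve; _⊕_; _⊗_; ⊝_; _⊜_; Κ)
  open ≡-Reasoning

  ^-distribʳ-* : ∀ m n i → (m ℕ.* n) ℕ.^ i ≡ m ℕ.^ i ℕ.* n ℕ.^ i
  ^-distribʳ-* m n zero    = refl
  ^-distribʳ-* m n (suc i) = trans (cong (m ℕ.* n ℕ.*_) (^-distribʳ-* m n i)) (interchange m n _ _)

  Combination : Set
  Combination = List (ℤ × ℕ)

  -- (c , s) stands for x ↦ c γ(a s x); its weight in the i-th moment is the factor it puts
  -- on the coefficient of x^i.
  weight : ℕ → ℕ → ℤ × ℕ → ℤ
  weight a i (c , s) = c * + ((a ℕ.* s) ℕ.^ i)

  moment : ℕ → Combination → ℕ → ℤ
  moment a []      i = 0ℤ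
  moment a (x ∷ D) i = weight a i x + moment a D i

  rescale : ℤ → ℕ → Combination → Combination
  rescale u t = map λ (c , s) → (u * c , s ℕ.* t)

  moment-++ : ∀ a D E i → moment a (D ++ E) i ≡ moment a D i + moment a E i
  moment-++ a []      E i = sym (ℤ.+-identityˡ (moment a E i))
  moment-++ a (x ∷ D) E i = trans (cong (λ m → weight a i x + m) (moment-++ a D E i))
                                  (sym (ℤ.+-assoc (weight a i x) (moment a D i) (moment a E i)))

  moment-rescale : ∀ a u t D i → moment a (rescale u t D) i ≡ u * + (t ℕ.^ i) * moment a D i
  moment-rescale a u t []            i = sym (ℤ.*-zeroʳ (u * + (t ℕ.^ i)))
  moment-rescale a u t ((c , s) ∷ D) i = begin
    u * c * + ((a ℕ.* (s ℕ.* t)) ℕ.^ i) + moment a (rescale u t D) i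
      ≡⟨ cong₂ (λ x y → u * c * x + y) node (moment-rescale a u t D i) ⟩
    u * c * (S * T) + u * T * M
      ≡⟨ solve 5 (λ u c T S M → (u ⊗ c ⊗ (S ⊗ T) ⊕ u ⊗ T ⊗ M) ⊜ (u ⊗ T ⊗ (c ⊗ S ⊕ M))) refl u c T S M ⟩
    u * T * (c * S + M) ∎
    where
    T S M : ℤ
    T = + (t ℕ.^ i)
    S = + ((a ℕ.* s) ℕ.^ i)
    M = moment a D i
    node : + ((a ℕ.* (s ℕ.* t)) ℕ.^ i) ≡ S * T
    node = begin
      + ((a ℕ.* (s ℕ.* t)) ℕ.^ i)     ≡⟨ cong (λ x → + (x ℕ.^ i)) (ℕ.*-assoc a s t) ⟨
      + ((a ℕ.* s ℕ.* t) ℕ.^ i)       ≡⟨ cong +_ (^-distribʳ-* (a ℕ.* s) t i) ⟩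
      + ((a ℕ.* s) ℕ.^ i ℕ.* t ℕ.^ i) ≡⟨ ℤ.pos-* ((a ℕ.* s) ℕ.^ i) (t ℕ.^ i) ⟩
      S * T ∎

  powerProduct : ℕ → ℕ → ℕ
  powerProduct a zero    = 1
  powerProduct a (suc n) = a ℕ.^ n ℕ.* powerProduct a n

  -- Q(X) − Q(0) for Q(X) = Π_{j<n} (a^j − X), where (c , s) stands for c X^e with a s = a^e,
  -- so that at X = a^i the monomial X^e becomes (a s)^i.
  annihilator : ℕ → ℕ → Combination
  annihilator a zero    = []
  annihilator a (suc n) =
    (- + powerProduct a n , 1) ∷ (rescale -1ℤ a (annihilator a n) ++ rescale (+ (a ℕ.^ n)) 1 (annihilator a n))

  annihilator-step : ∀ a n i →
    + powerProduct a (suc n) + moment a (annihilator a (suc n)) i ≡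
    (+ (a ℕ.^ n) - + (a ℕ.^ i)) * (+ powerProduct a n + moment a (annihilator a n) i)
  annihilator-step a n i = begin
    + (a ℕ.^ n ℕ.* powerProduct a n) + (- E * + ((a ℕ.* 1) ℕ.^ i) + moment a (rescale -1ℤ a D ++ rescale A′ 1 D) i)
      ≡⟨ cong₂ (λ x y → x + (- E * + ((a ℕ.* 1) ℕ.^ i) + y))
               (ℤ.pos-* (a ℕ.^ n) (powerProduct a n)) (moment-++ a (rescale -1ℤ a D) _ i) ⟩
    A′ * E + (- E * + ((a ℕ.* 1) ℕ.^ i) + (moment a (rescale -1ℤ a D) i + moment a (rescale A′ 1 D) i))
      ≡⟨ cong₂ (λ x y → A′ * E + (- E * + (x ℕ.^ i) + y))
               (ℕ.*-identityʳ a) (cong₂ _+_ (moment-rescale a -1ℤ a D i) (moment-rescale a A′ 1 D i)) ⟩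
    A′ * E + (- E * B + (-1ℤ * B * M + A′ * + (1 ℕ.^ i) * M))
      ≡⟨ cong (λ x → A′ * E + (- E * B + (-1ℤ * B * M + A′ * + x * M))) (ℕ.^-zeroˡ i) ⟩
    A′ * E + (- E * B + (-1ℤ * B * M + A′ * + 1 * M))
      ≡⟨ solve 4 (λ A B E M → (A ⊗ E ⊕ (⊝ E ⊗ B ⊕ (Κ -1ℤ ⊗ B ⊗ M ⊕ A ⊗ Κ (+ 1) ⊗ M)))
                              ⊜ ((A ⊕ ⊝ B) ⊗ (E ⊕ M))) refl A′ B E M ⟩
    (A′ - B) * (E + M) ∎
    where
    D : Combination
    D = annihilator a n
    A′ B E M : ℤ
    A′ = + (a ℕ.^ n)
    B = + (a ℕ.^ i)
    E = + powerProduct a n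
    M = moment a D i

  annihilator-vanishes : ∀ a n i → i ℕ.< n → + powerProduct a n + moment a (annihilator a n) i ≡ 0ℤ
  annihilator-vanishes a (suc n) i i<1+n with ℕ.m<1+n⇒m<n∨m≡n i<1+n
  ... | inj₁ i<n  = trans (annihilator-step a n i)
                          (trans (cong ((+ (a ℕ.^ n) - + (a ℕ.^ i)) *_) (annihilator-vanishes a n i i<n))
                                 (ℤ.*-zeroʳ (+ (a ℕ.^ n) - + (a ℕ.^ i))))
  ... | inj₂ refl = trans (annihilator-step a n n)
                          (cong (_* (+ powerProduct a n + moment a (annihilator a n) n)) (ℤ.+-inverseʳ (+ (a ℕ.^ n))))

  Comaximal : ℕ → ℕ → Set
  Comaximal m n = ∃₂ λ u v → u * + m + v * + n ≡ 1ℤ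

  comaximal-sym : ∀ {m n} → Comaximal m n → Comaximal n m
  comaximal-sym {m} {n} (u , v , eq) = v , u , trans (ℤ.+-comm (v * + n) (u * + m)) eq

  comaximal-*ˡ : ∀ {l m n} → Comaximal l n → Comaximal m n → Comaximal (l ℕ.* m) n
  comaximal-*ˡ {l} {m} {n} (u₁ , v₁ , eq₁) (u₂ , v₂ , eq₂) =
    u₁ * u₂ , u₁ * L * v₂ + v₁ * u₂ * M + v₁ * v₂ * N , (begin
      u₁ * u₂ * + (l ℕ.* m) + (u₁ * L * v₂ + v₁ * u₂ * M + v₁ * v₂ * N) * N
        ≡⟨ cong (λ x → u₁ * u₂ * x + (u₁ * L * v₂ + v₁ * u₂ * M + v₁ * v₂ * N) * N) (ℤ.pos-* l m) ⟩
      u₁ * u₂ * (L * M) + (u₁ * L * v₂ + v₁ * u₂ * M + v₁ * v₂ * N) * N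
        ≡⟨ solve 7 (λ L M N u₁ v₁ u₂ v₂ →
             (u₁ ⊗ u₂ ⊗ (L ⊗ M) ⊕ (u₁ ⊗ L ⊗ v₂ ⊕ v₁ ⊗ u₂ ⊗ M ⊕ v₁ ⊗ v₂ ⊗ N) ⊗ N)
             ⊜ ((u₁ ⊗ L ⊕ v₁ ⊗ N) ⊗ (u₂ ⊗ M ⊕ v₂ ⊗ N))) refl L M N u₁ v₁ u₂ v₂ ⟩
      (u₁ * L + v₁ * N) * (u₂ * M + v₂ * N)
        ≡⟨ cong₂ _*_ eq₁ eq₂ ⟩
      1ℤ ∎)
    where
    L M N : ℤ
    L = + l
    M = + m
    N = + n

  comaximal-^ : ∀ {m n} → Comaximal m n → ∀ e → Comaximal (m ℕ.^ e) n
  comaximal-^ c zero    = 1ℤ , 0ℤ , refl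
  comaximal-^ c (suc e) = comaximal-*ˡ c (comaximal-^ c e)

  comaximal-powerProduct : ∀ {m n} → Comaximal m n → ∀ e → Comaximal (powerProduct m e) n
  comaximal-powerProduct c zero    = 1ℤ , 0ℤ , refl
  comaximal-powerProduct c (suc e) = comaximal-*ˡ (comaximal-^ c e) (comaximal-powerProduct c e)

  bézout-ℕ⇒ℤ : ∀ {m n} x y → 1 ℕ.+ y ℕ.* n ≡ x ℕ.* m → + x * + m + - + y * + n ≡ 1ℤ
  bézout-ℕ⇒ℤ {m} {n} x y eq = begin
    + x * + m + - + y * + n       ≡⟨ cong (λ z → z + - + y * + n) (ℤ.pos-* x m) ⟨
    + (x ℕ.* m) + - + y * + n     ≡⟨ cong (λ z → + z + - + y * + n) eq ⟨
    + (1 ℕ.+ y ℕ.* n) + - + y * + n ≡⟨ cong (λ z → + 1 + z + - + y * + n) (ℤ.pos-* y n) ⟩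
    + 1 + + y * + n + - + y * + n ≡⟨ solve 2 (λ Y N → (Κ (+ 1) ⊕ Y ⊗ N ⊕ ⊝ Y ⊗ N) ⊜ Κ (+ 1)) refl (+ y) (+ n) ⟩
    1ℤ ∎

  coprime⇒comaximal : ∀ {m n} → Coprime m n → Comaximal m n
  coprime⇒comaximal {m} {n} c with coprime-Bézout c
  ... | Bézout.+- x y eq = + x , - + y , bézout-ℕ⇒ℤ x y eq
  ... | Bézout.-+ x y eq = - + x , + y , trans (ℤ.+-comm (- + x * + m) (+ y * + n)) (bézout-ℕ⇒ℤ y x eq)

  unit-moments : ∀ {a b} → Coprime a b → ∀ n →
                 ∃₂ λ Dᵃ Dᵇ → ∀ i → i ℕ.< n → moment a Dᵃ i + moment b Dᵇ i ≡ 1ℤ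
  unit-moments {a} {b} cop n =
    combine (comaximal-sym (comaximal-powerProduct (comaximal-sym (comaximal-powerProduct (coprime⇒comaximal cop) n)) n))
    where
    combine : Comaximal (powerProduct a n) (powerProduct b n) →
              ∃₂ λ Dᵃ Dᵇ → ∀ i → i ℕ.< n → moment a Dᵃ i + moment b Dᵇ i ≡ 1ℤ
    combine (u , v , bézout) = rescale (- u) 1 (annihilator a n) , rescale (- v) 1 (annihilator b n) , moments≡1
      where
      moments≡1 : ∀ i → i ℕ.< n →
                  moment a (rescale (- u) 1 (annihilator a n)) i + moment b (rescale (- v) 1 (annihilator b n)) i ≡ 1ℤ
      moments≡1 i i<n = begin
        moment a (rescale (- u) 1 (annihilator a n)) i + moment b (rescale (- v) 1 (annihilator b n)) i
          ≡⟨ cong₂ _+_ (moment-rescale a (- u) 1 (annihilator a n) i) (moment-rescale b (- v) 1 (annihilator b n) i) ⟩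
        - u * + (1 ℕ.^ i) * Mᵃ + - v * + (1 ℕ.^ i) * Mᵇ
          ≡⟨ cong (λ x → - u * + x * Mᵃ + - v * + x * Mᵇ) (ℕ.^-zeroˡ i) ⟩
        - u * + 1 * Mᵃ + - v * + 1 * Mᵇ
          ≡⟨ solve 6 (λ u v Eᵃ Eᵇ Mᵃ Mᵇ → (⊝ u ⊗ Κ (+ 1) ⊗ Mᵃ ⊕ ⊝ v ⊗ Κ (+ 1) ⊗ Mᵇ)
                        ⊜ (u ⊗ Eᵃ ⊕ v ⊗ Eᵇ ⊕ (⊝ u ⊗ (Eᵃ ⊕ Mᵃ) ⊕ ⊝ v ⊗ (Eᵇ ⊕ Mᵇ)))) refl u v Eᵃ Eᵇ Mᵃ Mᵇ ⟩
        u * Eᵃ + v * Eᵇ + (- u * (Eᵃ + Mᵃ) + - v * (Eᵇ + Mᵇ))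
          ≡⟨ cong₂ (λ x y → u * Eᵃ + v * Eᵇ + (- u * x + - v * y))
                   (annihilator-vanishes a n i i<n) (annihilator-vanishes b n i i<n) ⟩
        u * Eᵃ + v * Eᵇ + (- u * 0ℤ + - v * 0ℤ)
          ≡⟨ cong (_+ (- u * 0ℤ + - v * 0ℤ)) bézout ⟩
        1ℤ + (- u * 0ℤ + - v * 0ℤ)
          ≡⟨ solve 2 (λ u v → (Κ 1ℤ ⊕ (⊝ u ⊗ Κ 0ℤ ⊕ ⊝ v ⊗ Κ 0ℤ)) ⊜ Κ 1ℤ) refl u v ⟩
        1ℤ ∎
        where
        Eᵃ Eᵇ Mᵃ Mᵇ : ℤ
        Eᵃ = + powerProduct a n
        Eᵇ = + powerProduct b n
        Mᵃ = moment a (annihilator a n) i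
        Mᵇ = moment b (annihilator b n) i

open Moments using (Combination; moment; unit-moments)

module IntegerValuedPolynomials (ℝ : RealField) where

  open RealField ℝ
  open RealPoly ℝ

  commutativeRing : CommutativeRing 0ℓ 0ℓ
  commutativeRing = record { isCommutativeRing = isCommutativeRing }

  open CommutativeRing commutativeRing
    using (+-assoc; +-comm; *-assoc; +-identityˡ; +-identityʳ; zeroˡ; *-identityˡ; *-identityʳ; zeroʳ; distribˡ; distribʳ;
           -‿inverseʳ; ring; semiring; +-commutativeMonoid; *-commutativeSemigroup; *-commutativeMonoid)
  open import Algebra.Properties.Ring ring using (-1*x≈-x; -‿distribˡ-*; -‿distribʳ-*; -0#≈0#; -‿involutive; -‿+-comm)
  open import Algebra.Properties.CommutativeMonoid.Sum +-commutativeMonoid using (sum; sum-cong-≗; sum-replicate-zero; ∑-distrib-+)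
  open import Algebra.Properties.Semiring.Sum semiring using (*-distribˡ-sum)
  open import Algebra.Properties.CommutativeSemigroup *-commutativeSemigroup using (interchange)
  open import Algebra.Solver.CommutativeMonoid *-commutativeMonoid
    using () renaming (solve to *-solve; _⊕_ to _⊠_; _⊜_ to _⊜*_)
  open import Algebra.Solver.CommutativeMonoid +-commutativeMonoid
    using () renaming (solve to +-solve; _⊕_ to _⊞_; _⊜_ to _⊜⁺_)
  open IsStrictTotalOrder isStrictTotalOrder using (compare; irrefl) renaming (trans to <-trans)
  open ≡-Reasoning

  0<1 : 0# < 1#
  0<1 with compare 0# 1#
  ... | tri< 0<1 _ _ = 0<1
  ... | tri≈ _ 0≡1 _ = ⊥-elim (0≢1 0≡1)
  ... | tri> _ _ 1<0 = ⊥-elim (irrefl refl (<-trans 1<0 (subst (0# <_) -1*-1≡1 (*-pos _ _ 0<-1 0<-1))))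
    where
    0<-1 : 0# < - 1#
    0<-1 = subst₂ _<_ (-‿inverseʳ 1#) (+-identityˡ (- 1#)) (+-mono-< 1# 0# (- 1#) 1<0)
    -1*-1≡1 : - 1# * - 1# ≡ 1#
    -1*-1≡1 = trans (-1*x≈-x (- 1#)) (-‿involutive 1#)

  ιℕ-positive : ∀ n → 0# < ιℕ (suc n)
  ιℕ-positive zero    = subst (0# <_) (sym (+-identityʳ 1#)) 0<1
  ιℕ-positive (suc n) = <-trans (ιℕ-positive n) (subst (_< ιℕ (suc (suc n))) (+-identityˡ _) (+-mono-< 0# 1# _ 0<1))

  ιℕ-≢0 : ∀ {n} → n ≥ 1 → ιℕ n ≢ 0#
  ιℕ-≢0 {suc n} _ ιℕn≡0 = irrefl refl (subst (0# <_) ιℕn≡0 (ιℕ-positive n))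

  ιℕ-+ : ∀ m n → ιℕ (m ℕ.+ n) ≡ ιℕ m + ιℕ n
  ιℕ-+ zero    n = sym (+-identityˡ (ιℕ n))
  ιℕ-+ (suc m) n = trans (cong (1# +_) (ιℕ-+ m n)) (sym (+-assoc 1# (ιℕ m) (ιℕ n)))

  ιℕ-* : ∀ m n → ιℕ (m ℕ.* n) ≡ ιℕ m * ιℕ n
  ιℕ-* zero    n = sym (zeroˡ (ιℕ n))
  ιℕ-* (suc m) n = begin
    ιℕ (n ℕ.+ m ℕ.* n)   ≡⟨ ιℕ-+ n (m ℕ.* n) ⟩
    ιℕ n + ιℕ (m ℕ.* n)  ≡⟨ cong (ιℕ n +_) (ιℕ-* m n) ⟩
    ιℕ n + ιℕ m * ιℕ n   ≡⟨ cong (_+ ιℕ m * ιℕ n) (*-identityˡ (ιℕ n)) ⟨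
    1# * ιℕ n + ιℕ m * ιℕ n ≡⟨ distribʳ (ιℕ n) 1# (ιℕ m) ⟨
    (1# + ιℕ m) * ιℕ n   ∎

  ιℕ-^ : ∀ m n → ιℕ (m ℕ.^ n) ≡ ιℕ m ^ n
  ιℕ-^ m zero    = +-identityʳ 1#
  ιℕ-^ m (suc n) = trans (ιℕ-* m (m ℕ.^ n)) (cong (ιℕ m *_) (ιℕ-^ m n))

  ^-distribʳ-* : ∀ x y n → (x * y) ^ n ≡ x ^ n * y ^ n
  ^-distribʳ-* x y zero    = sym (*-identityˡ 1#)
  ^-distribʳ-* x y (suc n) = trans (cong (x * y *_) (^-distribʳ-* x y n)) (interchange x y _ _)

  ιℤ-neg : ∀ i → ιℤ (ℤ.- i) ≡ - ιℤ i
  ιℤ-neg (ℤ.+ zero)  = sym -0#≈0#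
  ιℤ-neg (ℤ.+ suc n) = refl
  ιℤ-neg ℤ.-[1+ n ]  = sym (-‿involutive _)

  ιℤ-⊖ : ∀ m n → ιℤ (m ℤ.⊖ n) ≡ ιℕ m + - ιℕ n
  ιℤ-⊖ m       zero    = sym (trans (cong (ιℕ m +_) -0#≈0#) (+-identityʳ (ιℕ m)))
  ιℤ-⊖ zero    (suc n) = sym (+-identityˡ _)
  ιℤ-⊖ (suc m) (suc n) = begin
    ιℤ (suc m ℤ.⊖ suc n)              ≡⟨ cong ιℤ (ℤ.[1+m]⊖[1+n]≡m⊖n m n) ⟩
    ιℤ (m ℤ.⊖ n)                      ≡⟨ ιℤ-⊖ m n ⟩
    ιℕ m + - ιℕ n                     ≡⟨ +-identityʳ _ ⟨
    ιℕ m + - ιℕ n + 0#                ≡⟨ cong (ιℕ m + - ιℕ n +_) (-‿inverseʳ 1#) ⟨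
    ιℕ m + - ιℕ n + (1# + - 1#)
      ≡⟨ +-solve 4 (λ M N′ I I′ → ((M ⊞ N′) ⊞ (I ⊞ I′)) ⊜⁺ ((I ⊞ M) ⊞ (I′ ⊞ N′))) refl (ιℕ m) (- ιℕ n) 1# (- 1#) ⟩
    1# + ιℕ m + (- 1# + - ιℕ n)       ≡⟨ cong (1# + ιℕ m +_) (-‿+-comm 1# (ιℕ n)) ⟩
    1# + ιℕ m + - (1# + ιℕ n)         ∎

  ιℤ-+ : ∀ i j → ιℤ (i ℤ.+ j) ≡ ιℤ i + ιℤ j
  ιℤ-+ (ℤ.+ m)    (ℤ.+ n)    = ιℕ-+ m n
  ιℤ-+ (ℤ.+ m)    ℤ.-[1+ n ] = ιℤ-⊖ m (suc n)
  ιℤ-+ ℤ.-[1+ m ] (ℤ.+ n)    = trans (ιℤ-⊖ n (suc m)) (+-comm (ιℕ n) _)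
  ιℤ-+ ℤ.-[1+ m ] ℤ.-[1+ n ] = begin
    - (1# + ιℕ (suc (m ℕ.+ n)))      ≡⟨ cong (λ x → - (1# + x)) (ιℕ-+ (suc m) n) ⟩
    - (1# + (ιℕ (suc m) + ιℕ n))
      ≡⟨ cong -_ (+-solve 3 (λ I M N → (I ⊞ ((I ⊞ M) ⊞ N)) ⊜⁺ ((I ⊞ M) ⊞ (I ⊞ N))) refl 1# (ιℕ m) (ιℕ n)) ⟩
    - (ιℕ (suc m) + ιℕ (suc n))     ≡⟨ -‿+-comm (ιℕ (suc m)) (ιℕ (suc n)) ⟨
    - ιℕ (suc m) + - ιℕ (suc n)     ∎

  ιℤ-*-+ : ∀ i n → ιℤ (i ℤ.* ℤ.+ n) ≡ ιℤ i * ιℕ n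
  ιℤ-*-+ (ℤ.+ m)    n = trans (cong ιℤ (sym (ℤ.pos-* m n))) (ιℕ-* m n)
  ιℤ-*-+ ℤ.-[1+ m ] n = begin
    ιℤ (ℤ.- (ℤ.+ suc m) ℤ.* ℤ.+ n)   ≡⟨ cong ιℤ (ℤ.neg-distribˡ-* (ℤ.+ suc m) (ℤ.+ n)) ⟨
    ιℤ (ℤ.- (ℤ.+ suc m ℤ.* ℤ.+ n))   ≡⟨ ιℤ-neg (ℤ.+ suc m ℤ.* ℤ.+ n) ⟩
    - ιℤ (ℤ.+ suc m ℤ.* ℤ.+ n)       ≡⟨ cong -_ (ιℤ-*-+ (ℤ.+ suc m) n) ⟩
    - (ιℕ (suc m) * ιℕ n)            ≡⟨ -‿distribˡ-* (ιℕ (suc m)) (ιℕ n) ⟩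
    - ιℕ (suc m) * ιℕ n              ∎

  ιℤ-* : ∀ i j → ιℤ (i ℤ.* j) ≡ ιℤ i * ιℤ j
  ιℤ-* i (ℤ.+ n)    = ιℤ-*-+ i n
  ιℤ-* i ℤ.-[1+ n ] = begin
    ιℤ (i ℤ.* ℤ.- (ℤ.+ suc n))   ≡⟨ cong ιℤ (ℤ.neg-distribʳ-* i (ℤ.+ suc n)) ⟨
    ιℤ (ℤ.- (i ℤ.* ℤ.+ suc n))   ≡⟨ ιℤ-neg (i ℤ.* ℤ.+ suc n) ⟩
    - ιℤ (i ℤ.* ℤ.+ suc n)       ≡⟨ cong -_ (ιℤ-*-+ i (suc n)) ⟩
    - (ιℤ i * ιℕ (suc n))        ≡⟨ -‿distribʳ-* (ιℤ i) (ιℕ (suc n)) ⟩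
    ιℤ i * - ιℕ (suc n)          ∎

  IsInt : Carrier → Set
  IsInt x = ∃ λ m → x ≡ ιℤ m

  IsInt-+ : ∀ {x y} → IsInt x → IsInt y → IsInt (x + y)
  IsInt-+ (m , x≡m) (n , y≡n) = m ℤ.+ n , trans (cong₂ _+_ x≡m y≡n) (sym (ιℤ-+ m n))

  IsInt-* : ∀ c {x} → IsInt x → IsInt (ιℤ c * x)
  IsInt-* c (m , x≡m) = c ℤ.* m , trans (cong (ιℤ c *_) x≡m) (sym (ιℤ-* c m))

  ⁻¹-unique : ∀ {x y} → x ≢ 0# → x * y ≡ 1# → y ≡ x ⁻¹
  ⁻¹-unique {x} {y} x≢0 xy≡1 = begin
    y                ≡⟨ *-identityʳ y ⟨
    y * 1#           ≡⟨ cong (y *_) (⁻¹-inverse x x≢0) ⟨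
    y * (x * x ⁻¹)   ≡⟨ *-solve 3 (λ x y x′ → (y ⊠ (x ⊠ x′)) ⊜* ((x ⊠ y) ⊠ x′)) refl x y (x ⁻¹) ⟩
    x * y * x ⁻¹     ≡⟨ cong (_* x ⁻¹) xy≡1 ⟩
    1# * x ⁻¹        ≡⟨ *-identityˡ (x ⁻¹) ⟩
    x ⁻¹             ∎

  ⁻¹-distrib-* : ∀ {x y} → x ≢ 0# → y ≢ 0# → x * y ≢ 0# → (x * y) ⁻¹ ≡ x ⁻¹ * y ⁻¹
  ⁻¹-distrib-* {x} {y} x≢0 y≢0 xy≢0 = sym (⁻¹-unique xy≢0 (begin
    x * y * (x ⁻¹ * y ⁻¹)
      ≡⟨ *-solve 4 (λ x y x′ y′ → ((x ⊠ y) ⊠ (x′ ⊠ y′)) ⊜* ((x ⊠ x′) ⊠ (y ⊠ y′))) refl x y (x ⁻¹) (y ⁻¹) ⟩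
    x * x ⁻¹ * (y * y ⁻¹)     ≡⟨ cong₂ _*_ (⁻¹-inverse x x≢0) (⁻¹-inverse y y≢0) ⟩
    1# * 1#                   ≡⟨ *-identityˡ 1# ⟩
    1#                        ∎))

  *-/-cancel : ∀ x {y} → y ≢ 0# → y * (x / y) ≡ x
  *-/-cancel x {y} y≢0 = begin
    y * (x * y ⁻¹)  ≡⟨ *-solve 3 (λ x y y′ → (y ⊠ (x ⊠ y′)) ⊜* (x ⊠ (y ⊠ y′))) refl x y (y ⁻¹) ⟩
    x * (y * y ⁻¹)  ≡⟨ cong (x *_) (⁻¹-inverse y y≢0) ⟩
    x * 1#          ≡⟨ *-identityʳ x ⟩
    x               ∎

  *-/-*-cancel : ∀ x {y z} → y ≢ 0# → z ≢ 0# → y * z ≢ 0# → y * (x / (y * z)) ≡ x / z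
  *-/-*-cancel x {y} {z} y≢0 z≢0 yz≢0 = begin
    y * (x * (y * z) ⁻¹)      ≡⟨ cong (λ w → y * (x * w)) (⁻¹-distrib-* y≢0 z≢0 yz≢0) ⟩
    y * (x * (y ⁻¹ * z ⁻¹))
      ≡⟨ *-solve 4 (λ x y y′ z′ → (y ⊠ (x ⊠ (y′ ⊠ z′))) ⊜* (y ⊠ ((x ⊠ z′) ⊠ y′))) refl x y (y ⁻¹) (z ⁻¹) ⟩
    y * (x * z ⁻¹ * y ⁻¹)     ≡⟨ *-/-cancel (x / z) y≢0 ⟩
    x / z                     ∎

  *-/ιℕ-*-cancel : ∀ x {m n} → m ≥ 1 → n ≥ 1 → ιℕ m * (x / ιℕ (m ℕ.* n)) ≡ x / ιℕ n
  *-/ιℕ-*-cancel x {m} {n} m≥1 n≥1 =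
    trans (cong (λ y → ιℕ m * (x / y)) (ιℕ-* m n))
          (*-/-*-cancel x (ιℕ-≢0 m≥1) (ιℕ-≢0 n≥1) (subst (_≢ 0#) (ιℕ-* m n) (ιℕ-≢0 (ℕ.*-mono-≤ m≥1 n≥1))))

  sumFin≡sum : ∀ n (f : Fin n → Carrier) → sumFin n f ≡ sum f
  sumFin≡sum zero    f = refl
  sumFin≡sum (suc n) f = cong (f zero +_) (sumFin≡sum n (λ i → f (suc i)))

  module DegreeAtMost (k : ℕ) where

    eval≡sum : ∀ (γ : Poly≤ k) y → eval γ y ≡ sum (λ i → γ i * y ^ toℕ i)
    eval≡sum γ y = sumFin≡sum (suc k) (λ i → γ i * y ^ toℕ i)

    eval-cong : ∀ {p q : Poly≤ k} → (∀ i → p i ≡ q i) → ∀ y → eval p y ≡ eval q y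
    eval-cong {p} {q} p≗q y = begin
      eval p y                        ≡⟨ eval≡sum p y ⟩
      sum (λ i → p i * y ^ toℕ i)     ≡⟨ sum-cong-≗ (λ i → cong (_* y ^ toℕ i) (p≗q i)) ⟩
      sum (λ i → q i * y ^ toℕ i)     ≡⟨ eval≡sum q y ⟨
      eval q y                        ∎

    eval-+ : ∀ (p q : Poly≤ k) y → eval (λ i → p i + q i) y ≡ eval p y + eval q y
    eval-+ p q y = begin
      eval (λ i → p i + q i) y
        ≡⟨ eval≡sum (λ i → p i + q i) y ⟩
      sum (λ i → (p i + q i) * y ^ toℕ i)
        ≡⟨ sum-cong-≗ (λ i → distribʳ (y ^ toℕ i) (p i) (q i)) ⟩
      sum (λ i → p i * y ^ toℕ i + q i * y ^ toℕ i)
        ≡⟨ ∑-distrib-+ (λ i → p i * y ^ toℕ i) (λ i → q i * y ^ toℕ i) ⟩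
      sum (λ i → p i * y ^ toℕ i) + sum (λ i → q i * y ^ toℕ i)
        ≡⟨ cong₂ _+_ (eval≡sum p y) (eval≡sum q y) ⟨
      eval p y + eval q y ∎

    eval-dilation : ∀ (γ : Poly≤ k) c t y → eval (λ i → γ i * (c * t ^ toℕ i)) y ≡ c * eval γ (t * y)
    eval-dilation γ c t y = begin
      eval (λ i → γ i * (c * t ^ toℕ i)) y               ≡⟨ eval≡sum (λ i → γ i * (c * t ^ toℕ i)) y ⟩
      sum (λ i → γ i * (c * t ^ toℕ i) * y ^ toℕ i)      ≡⟨ sum-cong-≗ term ⟩
      sum (λ i → c * (γ i * (t * y) ^ toℕ i))            ≡⟨ *-distribˡ-sum c (λ i → γ i * (t * y) ^ toℕ i) ⟨
      c * sum (λ i → γ i * (t * y) ^ toℕ i)              ≡⟨ cong (c *_) (eval≡sum γ (t * y)) ⟨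
      c * eval γ (t * y)                                 ∎
      where
      term : ∀ i → γ i * (c * t ^ toℕ i) * y ^ toℕ i ≡ c * (γ i * (t * y) ^ toℕ i)
      term i = begin
        γ i * (c * t ^ toℕ i) * y ^ toℕ i
          ≡⟨ *-solve 4 (λ g c T Y → ((g ⊠ (c ⊠ T)) ⊠ Y) ⊜* (c ⊠ (g ⊠ (T ⊠ Y)))) refl (γ i) c (t ^ toℕ i) (y ^ toℕ i) ⟩
        c * (γ i * (t ^ toℕ i * y ^ toℕ i))    ≡⟨ cong (λ w → c * (γ i * w)) (^-distribʳ-* t y (toℕ i)) ⟨
        c * (γ i * (t * y) ^ toℕ i)            ∎

    dilate : ℕ → Combination → Poly≤ k → Poly≤ k
    dilate a D γ i = γ i * ιℤ (moment a D (toℕ i))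

    eval-dilate-[] : ∀ a (γ : Poly≤ k) y → eval (dilate a [] γ) y ≡ 0#
    eval-dilate-[] a γ y = begin
      eval (λ i → γ i * 0#) y            ≡⟨ eval≡sum (λ i → γ i * 0#) y ⟩
      sum (λ i → γ i * 0# * y ^ toℕ i)   ≡⟨ sum-cong-≗ (λ i → trans (cong (_* y ^ toℕ i) (zeroʳ (γ i))) (zeroˡ _)) ⟩
      sum {suc k} (λ _ → 0#)             ≡⟨ sum-replicate-zero (suc k) ⟩
      0#                                 ∎

    eval-dilate-∷ : ∀ a c s D (γ : Poly≤ k) y →
                    eval (dilate a ((c , s) ∷ D) γ) y ≡ ιℤ c * eval γ (ιℕ (a ℕ.* s) * y) + eval (dilate a D γ) y
    eval-dilate-∷ a c s D γ y = begin
      eval (dilate a ((c , s) ∷ D) γ) y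
        ≡⟨ eval-cong coefficient y ⟩
      eval (λ i → γ i * (ιℤ c * ιℕ (a ℕ.* s) ^ toℕ i) + dilate a D γ i) y
        ≡⟨ eval-+ (λ i → γ i * (ιℤ c * ιℕ (a ℕ.* s) ^ toℕ i)) (dilate a D γ) y ⟩
      eval (λ i → γ i * (ιℤ c * ιℕ (a ℕ.* s) ^ toℕ i)) y + eval (dilate a D γ) y
        ≡⟨ cong (_+ eval (dilate a D γ) y) (eval-dilation γ (ιℤ c) (ιℕ (a ℕ.* s)) y) ⟩
      ιℤ c * eval γ (ιℕ (a ℕ.* s) * y) + eval (dilate a D γ) y ∎
      where
      coefficient : ∀ i → dilate a ((c , s) ∷ D) γ i ≡ γ i * (ιℤ c * ιℕ (a ℕ.* s) ^ toℕ i) + dilate a D γ i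
      coefficient i = begin
        γ i * ιℤ (c ℤ.* ℤ.+ ((a ℕ.* s) ℕ.^ toℕ i) ℤ.+ moment a D (toℕ i))
          ≡⟨ cong (γ i *_) (ιℤ-+ (c ℤ.* ℤ.+ ((a ℕ.* s) ℕ.^ toℕ i)) (moment a D (toℕ i))) ⟩
        γ i * (ιℤ (c ℤ.* ℤ.+ ((a ℕ.* s) ℕ.^ toℕ i)) + ιℤ (moment a D (toℕ i)))
          ≡⟨ cong (λ w → γ i * (w + ιℤ (moment a D (toℕ i))))
                  (trans (ιℤ-* c _) (cong (ιℤ c *_) (ιℕ-^ (a ℕ.* s) (toℕ i)))) ⟩
        γ i * (ιℤ c * ιℕ (a ℕ.* s) ^ toℕ i + ιℤ (moment a D (toℕ i)))
          ≡⟨ distribˡ (γ i) _ _ ⟩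
        γ i * (ιℤ c * ιℕ (a ℕ.* s) ^ toℕ i) + dilate a D γ i ∎

    IntOn-coarsen : ∀ m {δ δ′} (γ : Poly≤ k) → ιℕ m * δ ≡ δ′ → IntOn δ γ → IntOn δ′ γ
    IntOn-coarsen m {δ} γ refl int n = subst IsInt (cong (eval γ) point) (int (ℤ.+ m ℤ.* n))
      where
      point : δ * ιℤ (ℤ.+ m ℤ.* n) ≡ ιℕ m * δ * ιℤ n
      point = trans (cong (δ *_) (ιℤ-* (ℤ.+ m) n))
                    (*-solve 3 (λ d M N → (d ⊠ (M ⊠ N)) ⊜* ((M ⊠ d) ⊠ N)) refl δ (ιℕ m) (ιℤ n))

    IntOn-+ : ∀ {δ} (γ p q : Poly≤ k) → IntOn δ p → IntOn δ q →
              (∀ y → eval γ y ≡ eval p y + eval q y) → IntOn δ γ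
    IntOn-+ {δ} γ p q int-p int-q γ≗p+q n = subst IsInt (sym (γ≗p+q (δ * ιℤ n))) (IsInt-+ (int-p n) (int-q n))

    IntOn-dilate : ∀ a D {δ δ′} (γ : Poly≤ k) → ιℕ a * δ ≡ δ′ → IntOn δ′ γ → IntOn δ (dilate a D γ)
    IntOn-dilate a []            {δ} γ _    _   n = subst IsInt (sym (eval-dilate-[] a γ (δ * ιℤ n))) (ℤ.+ 0 , refl)
    IntOn-dilate a ((c , s) ∷ D) {δ} {δ′} γ aδ≡δ′ int n =
      subst IsInt (sym (eval-dilate-∷ a c s D γ (δ * ιℤ n)))
            (IsInt-+ (IsInt-* c node) (IntOn-dilate a D γ aδ≡δ′ int n))
      where
      node : IsInt (eval γ (ιℕ (a ℕ.* s) * (δ * ιℤ n)))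
      node = subst IsInt (cong (eval γ) (*-assoc (ιℕ (a ℕ.* s)) δ (ιℤ n)))
                   (IntOn-coarsen s γ (sym asδ≡sδ′) int n)
        where
        asδ≡sδ′ : ιℕ (a ℕ.* s) * δ ≡ ιℕ s * δ′
        asδ≡sδ′ = begin
          ιℕ (a ℕ.* s) * δ     ≡⟨ cong (_* δ) (ιℕ-* a s) ⟩
          ιℕ a * ιℕ s * δ      ≡⟨ *-solve 3 (λ A S d → ((A ⊠ S) ⊠ d) ⊜* (S ⊠ (A ⊠ d))) refl (ιℕ a) (ιℕ s) δ ⟩
          ιℕ s * (ιℕ a * δ)    ≡⟨ cong (ιℕ s *_) aδ≡δ′ ⟩
          ιℕ s * δ′            ∎

    dilations-split : ∀ {a b} Dᵃ Dᵇ → (∀ i → i ℕ.< suc k → moment a Dᵃ i ℤ.+ moment b Dᵇ i ≡ ℤ.+ 1) →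
                      ∀ (γ : Poly≤ k) y → eval γ y ≡ eval (dilate a Dᵃ γ) y + eval (dilate b Dᵇ γ) y
    dilations-split {a} {b} Dᵃ Dᵇ unit γ y =
      trans (eval-cong coefficient y) (eval-+ (dilate a Dᵃ γ) (dilate b Dᵇ γ) y)
      where
      coefficient : ∀ i → γ i ≡ dilate a Dᵃ γ i + dilate b Dᵇ γ i
      coefficient i = begin
        γ i                                    ≡⟨ *-identityʳ (γ i) ⟨
        γ i * 1#                               ≡⟨ cong (γ i *_) (+-identityʳ 1#) ⟨
        γ i * ιℤ (ℤ.+ 1)                       ≡⟨ cong (λ m → γ i * ιℤ m) (unit (toℕ i) (toℕ<n i)) ⟨
        γ i * ιℤ (moment a Dᵃ (toℕ i) ℤ.+ moment b Dᵇ (toℕ i))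
          ≡⟨ cong (γ i *_) (ιℤ-+ (moment a Dᵃ (toℕ i)) (moment b Dᵇ (toℕ i))) ⟩
        γ i * (ιℤ (moment a Dᵃ (toℕ i)) + ιℤ (moment b Dᵇ (toℕ i)))
          ≡⟨ distribˡ (γ i) _ _ ⟩
        dilate a Dᵃ γ i + dilate b Dᵇ γ i      ∎

lemma2p2 : (ℝ : RealField) → (a b : ℕ) → a ≥ 1 → b ≥ 1 → Coprime a b → (k : ℕ) →
           (λ₀ : RealField.Carrier ℝ) → RealField._<_ ℝ (RealField.0# ℝ) λ₀ →
           let open RealField ℝ
               open RealPoly ℝ
           in
           ((∀ (γ₁ γ₂ : Poly≤ k) → IntOn (λ₀ / ιℕ a) γ₁ → IntOn (λ₀ / ιℕ b) γ₂ →
               Σ (Poly≤ k) λ γ → IntOn λ₀ γ × (∀ x → eval γ x ≡ eval γ₁ x + eval γ₂ x))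
           × (∀ (γ : Poly≤ k) → IntOn λ₀ γ →
               Σ (Poly≤ k) λ γ₁ → Σ (Poly≤ k) λ γ₂ →
                 IntOn (λ₀ / ιℕ a) γ₁ × IntOn (λ₀ / ιℕ b) γ₂ ×
                 (∀ x → eval γ x ≡ eval γ₁ x + eval γ₂ x)))
           × (∀ (γ : Poly≤ k) →
               (IntOn (λ₀ / ιℕ a) γ × IntOn (λ₀ / ιℕ b) γ) ⇔ IntOn (λ₀ / ιℕ (a ℕ.* b)) γ)
lemma2p2 ℝ a b a≥1 b≥1 cop k λ₀ _ =
  ( (λ γ₁ γ₂ int₁ int₂ →
       (λ i → γ₁ i + γ₂ i) ,
       IntOn-+ (λ i → γ₁ i + γ₂ i) γ₁ γ₂
               (IntOn-coarsen a γ₁ a*λ/a int₁) (IntOn-coarsen b γ₂ b*λ/b int₂) (eval-+ γ₁ γ₂) ,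
       eval-+ γ₁ γ₂)
  , (λ γ int →
       dilate a Dᵃ γ , dilate b Dᵇ γ ,
       IntOn-dilate a Dᵃ γ a*λ/a int , IntOn-dilate b Dᵇ γ b*λ/b int ,
       split γ) )
  , λ γ → mk⇔
      (λ (int₁ , int₂) →
         IntOn-+ γ (dilate a Dᵃ γ) (dilate b Dᵇ γ)
                 (IntOn-dilate a Dᵃ γ a*λ/ab int₂) (IntOn-dilate b Dᵇ γ b*λ/ab int₁) (split γ))
      (λ int → IntOn-coarsen b γ b*λ/ab int , IntOn-coarsen a γ a*λ/ab int)
  where
  open RealField ℝ
  open RealPoly ℝ
  open IntegerValuedPolynomials ℝ
  open DegreeAtMost k

  unit : ∃₂ λ Dᵃ Dᵇ → ∀ i → i ℕ.< suc k → moment a Dᵃ i ℤ.+ moment b Dᵇ i ≡ ℤ.1ℤ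
  unit = unit-moments cop (suc k)

  Dᵃ Dᵇ : Combination
  Dᵃ = proj₁ unit
  Dᵇ = proj₁ (proj₂ unit)

  split : ∀ (γ : Poly≤ k) y → eval γ y ≡ eval (dilate a Dᵃ γ) y + eval (dilate b Dᵇ γ) y
  split = dilations-split Dᵃ Dᵇ (proj₂ (proj₂ unit))

  a*λ/a : ιℕ a * (λ₀ / ιℕ a) ≡ λ₀
  a*λ/a = *-/-cancel λ₀ (ιℕ-≢0 a≥1)

  b*λ/b : ιℕ b * (λ₀ / ιℕ b) ≡ λ₀
  b*λ/b = *-/-cancel λ₀ (ιℕ-≢0 b≥1)

  a*λ/ab : ιℕ a * (λ₀ / ιℕ (a ℕ.* b)) ≡ λ₀ / ιℕ b
  a*λ/ab = *-/ιℕ-*-cancel λ₀ a≥1 b≥1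

  b*λ/ab : ιℕ b * (λ₀ / ιℕ (a ℕ.* b)) ≡ λ₀ / ιℕ a
  b*λ/ab = subst (λ n → ιℕ b * (λ₀ / ιℕ n) ≡ λ₀ / ιℕ a) (ℕ.*-comm b a) (*-/ιℕ-*-cancel λ₀ b≥1 a≥1)
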